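{- For every finite poset $P$ with $k$ points and every positive integer $m$, $$1\le\frac{e(m+1,P)}{d(P)\,e(m,P)}<1+m^{ -1}2^k d(P)\le 1+m^{ -1}4^k.$$
   Context: $d(P)$ is the number of downsets of $P$. For a finite poset $P$ on $K$ and a finite set $M$ disjoint from $K$ with $|M|=m$, $e(m,P)$ is the number of partial orders on $M\cup K$ inducing $P$ on $K$ whose set of minimal elements is exactly $M$. -}

module Defs where

open import Data.Nat using (ℕ; zero; suc; _+_; _<_)
open import Data.Nat.Properties using (_<?_)
open import Data.Bool using (Bool; true; false)
open import Data.Bool.Properties using () renaming (_≟_ to _≟ᵇ_)
open import Data.Fin using (Fin; toℕ; _↑ʳ_)
open import Data.Fin.Properties using (all?) renaming (_≟_ to _≟ᶠ_)
open import Data.List using (List; []; _∷_; length; filter; concatMap; map)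
open import Data.Product using (_×_)
open import Data.Vec.Functional as VF using ()
open import Relation.Binary.PropositionalEquality using (_≡_)
open import Relation.Nullary using (Dec)
open import Relation.Nullary.Decidable using (_×-dec_; _→-dec_)

-- A (Bool-valued) binary relation on the finite set Fin n;  R x y ≡ true  means  x ≤ y.
BRel : ℕ → Set
BRel n = Fin n → Fin n → Bool

IsPartialOrderB : ∀ {n} → BRel n → Set
IsPartialOrderB {n} R =
  ((x : Fin n) → R x x ≡ true) ×
  ((x y : Fin n) → R x y ≡ true → R y x ≡ true → x ≡ y) ×
  ((x y z : Fin n) → R x y ≡ true → R y z ≡ true → R x z ≡ true)

record FinPoset (k : ℕ) : Set where
  field
    _≤ₚ_ : BRel k
    isPO : IsPartialOrderB _≤ₚ_
open FinPoset public

allFuns : {A : Set} → (n : ℕ) → List A → List (Fin n → A)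
allFuns zero    as = (λ ()) ∷ []
allFuns (suc n) as = concatMap (λ f → map (λ a → a VF.∷ f) as) (allFuns n as)

bools : List Bool
bools = true ∷ false ∷ []

allSubsets : (n : ℕ) → List (Fin n → Bool)
allSubsets n = allFuns n bools

allBRels : (n : ℕ) → List (BRel n)
allBRels n = allFuns n (allSubsets n)

IsDownset : ∀ {k} → FinPoset k → (Fin k → Bool) → Set
IsDownset {k} P D = (x y : Fin k) → _≤ₚ_ P x y ≡ true → D y ≡ true → D x ≡ true

isDownset? : ∀ {k} (P : FinPoset k) (D : Fin k → Bool) → Dec (IsDownset P D)
isDownset? P D = all? λ x → all? λ y →
  (_≤ₚ_ P x y ≟ᵇ true) →-dec (D y ≟ᵇ true) →-dec (D x ≟ᵇ true)

d : ∀ {k} → FinPoset k → ℕ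
d {k} P = length (filter (isDownset? P) (allSubsets k))

isPartialOrderB? : ∀ {n} (R : BRel n) → Dec (IsPartialOrderB R)
isPartialOrderB? R =
  (all? λ x → R x x ≟ᵇ true) ×-dec
  (all? λ x → all? λ y → (R x y ≟ᵇ true) →-dec (R y x ≟ᵇ true) →-dec (x ≟ᶠ y)) ×-dec
  (all? λ x → all? λ y → all? λ z →
     (R x y ≟ᵇ true) →-dec (R y z ≟ᵇ true) →-dec (R x z ≟ᵇ true))

IsMinimal : ∀ {n} → BRel n → Fin n → Set
IsMinimal {n} R x = (y : Fin n) → R y x ≡ true → y ≡ x

isMinimal? : ∀ {n} (R : BRel n) (x : Fin n) → Dec (IsMinimal R x)
isMinimal? R x = all? λ y → (R y x ≟ᵇ true) →-dec (y ≟ᶠ x)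

-- Ground set M ∪ K is Fin (m + k): M = the first m elements (toℕ x < m),
-- K = the last k elements, the j-th point of K being  m ↑ʳ j.
IsExtension : ∀ (m : ℕ) {k} → FinPoset k → BRel (m + k) → Set
IsExtension m {k} P R =
  IsPartialOrderB R ×
  ((i j : Fin k) → R (m ↑ʳ i) (m ↑ʳ j) ≡ _≤ₚ_ P i j) ×
  ((x : Fin (m + k)) → IsMinimal R x → toℕ x < m) ×
  ((x : Fin (m + k)) → toℕ x < m → IsMinimal R x)

isExtension? : ∀ (m : ℕ) {k} (P : FinPoset k) (R : BRel (m + k)) → Dec (IsExtension m P R)
isExtension? m P R =
  isPartialOrderB? R ×-dec
  (all? λ i → all? λ j → R (m ↑ʳ i) (m ↑ʳ j) ≟ᵇ _≤ₚ_ P i j) ×-dec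
  (all? λ x → isMinimal? R x →-dec (toℕ x <? m)) ×-dec
  (all? λ x → (toℕ x <? m) →-dec isMinimal? R x)

e : (m : ℕ) → ∀ {k} → FinPoset k → ℕ
e m {k} P = length (filter (isExtension? m P) (allBRels (m + k)))

-- An extension of P by m new minimal elements a is determined by the up-sets of the a in K;
-- their complements are downsets of P, and the new elements are exactly the minimal ones iff
-- these up-sets cover K. Hence e(m,P) = #cov K m, where #cov S m counts the m-tuples of
-- downsets whose complements cover S ⊆ K, and #uncov S m = d^m − #cov S m counts the rest.
-- Splitting off the first downset a gives #cov S (m+1) = Σₐ #cov (S∩a) m, and likewise for
-- #uncov. As #cov is antitone in S, d·#cov K m ≤ #cov K (m+1). Along the same recursion,
-- induction on m gives m·#uncov S m ≤ #cov S m · #meet S, where #meet S < d counts the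
-- downsets meeting S (the empty one does not). Then m·#cov K (m+1) ≤ m·d·(#cov + #uncov)
-- ≤ d·#cov·(m + #meet K) < d·#cov·(m + 2^k d), and d ≤ 2^k gives the last bound.
module Submission where

open import Defs
open import Data.Bool using (Bool; true; false; not; _∧_)
open import Data.Bool.Properties using (not-involutive; ¬-not; ∧-zeroʳ) renaming (_≟_ to _≟ᵇ_)
open import Data.Empty using (⊥-elim)
open import Data.Fin using (Fin; zero; suc; toℕ; _↑ˡ_; _↑ʳ_; splitAt; join)
open import Data.Fin.Properties
  using (all?; any?; toℕ<n; toℕ-↑ˡ; toℕ-↑ʳ; ↑ˡ-injective; splitAt-↑ˡ; splitAt-↑ʳ;
         splitAt⁻¹-↑ˡ; splitAt⁻¹-↑ʳ; join-splitAt)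
  renaming (_≟_ to _≟ᶠ_)
open import Data.List using (List; []; _∷_; length; filter; map; concatMap; _++_; allFin; cartesianProductWith)
open import Data.List.Properties using (length-removeAt′) renaming (length-filter to length-filter-≤)
open import Data.List.Membership.Propositional using (_∈_)
open import Data.List.Membership.Propositional.Properties
  using (∈-allFin; ∈-filter⁻; ∈-cartesianProductWith⁻)
import Data.List.Membership.Setoid as SetoidMembership
import Data.List.Membership.Setoid.Properties as SetoidMembershipₚ
import Data.List.Relation.Unary.All as All
open import Data.List.Relation.Unary.AllPairs using ([]; _∷_)
open import Data.List.Relation.Unary.Any as Any using (Any; here; there; _─_)
open import Data.List.Relation.Unary.Unique.Setoid using (Unique)
import Data.List.Relation.Unary.Unique.Setoid.Properties as Uniqueₚ
open import Data.Nat using (ℕ; zero; suc; _+_; _*_; _^_; _≤_; _<_; z≤n; s≤s; s≤s⁻¹; >-nonZero)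
open import Data.Nat.Properties
open import Algebra.Properties.CommutativeSemigroup +-commutativeSemigroup
  using (interchange; x∙yz≈y∙xz)
open import Data.Nat.Tactic.RingSolver using (solve-∀)
open import Data.Product using (_×_; _,_; proj₁; proj₂; ∃-syntax)
open import Data.Sum using (_⊎_; inj₁; inj₂)
import Data.Vec.Functional as Vector
import Data.Vec.Functional.Relation.Binary.Pointwise.Properties as Pointwise
open import Function using (_∘_)
open import Level using (0ℓ)
open import Relation.Binary.Bundles using (Setoid)
open import Relation.Binary.PropositionalEquality
open import Relation.Nullary using (Dec; yes; no; ¬_; does)
open import Relation.Nullary.Decidable using (¬?; _×-dec_; _→-dec_; decidable-stable; dec-true)

^-distribʳ-* : ∀ m n o → (m * n) ^ o ≡ m ^ o * n ^ o
^-distribʳ-* m n zero    = refl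
^-distribʳ-* m n (suc o) =
  trans (cong (m * n *_) (^-distribʳ-* m n o)) ([m*n]*[o*p]≡[m*o]*[n*p] m n (m ^ o) (n ^ o))

∑ : {A : Set} → List A → (A → ℕ) → ℕ
∑ []       f = 0
∑ (x ∷ xs) f = f x + ∑ xs f

syntax ∑ xs (λ x → e) = ∑[ x ← xs ] e

𝟙 : {X : Set} → Dec X → ℕ
𝟙 (yes _) = 1
𝟙 (no  _) = 0

module _ {A : Set} where

  ∑-cong : (xs : List A) {f g : A → ℕ} → (∀ x → f x ≡ g x) → ∑ xs f ≡ ∑ xs g
  ∑-cong []       _   = refl
  ∑-cong (x ∷ xs) f≡g = cong₂ _+_ (f≡g x) (∑-cong xs f≡g)

  ∑-zero : (xs : List A) {f : A → ℕ} → (∀ x → f x ≡ 0) → ∑ xs f ≡ 0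
  ∑-zero []       _    = refl
  ∑-zero (x ∷ xs) f≡0 = cong₂ _+_ (f≡0 x) (∑-zero xs f≡0)

  ∑-mono-≤ : (xs : List A) {f g : A → ℕ} → (∀ x → f x ≤ g x) → ∑ xs f ≤ ∑ xs g
  ∑-mono-≤ []       _   = z≤n
  ∑-mono-≤ (x ∷ xs) f≤g = +-mono-≤ (f≤g x) (∑-mono-≤ xs f≤g)

  ∑-const : (xs : List A) (c : ℕ) → ∑ xs (λ _ → c) ≡ length xs * c
  ∑-const []       c = refl
  ∑-const (x ∷ xs) c = cong (c +_) (∑-const xs c)

  length≡∑1 : (xs : List A) → length xs ≡ ∑ xs (λ _ → 1)
  length≡∑1 xs = sym (trans (∑-const xs 1) (*-identityʳ (length xs)))

  ∑-+ : (xs : List A) (f g : A → ℕ) → ∑[ x ← xs ] (f x + g x) ≡ ∑ xs f + ∑ xs g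
  ∑-+ []       f g = refl
  ∑-+ (x ∷ xs) f g =
    trans (cong (f x + g x +_) (∑-+ xs f g)) (interchange (f x) (g x) (∑ xs f) (∑ xs g))

  ∑-*ˡ : (c : ℕ) (xs : List A) (f : A → ℕ) → ∑[ x ← xs ] (c * f x) ≡ c * ∑ xs f
  ∑-*ˡ c []       f = sym (*-zeroʳ c)
  ∑-*ˡ c (x ∷ xs) f =
    trans (cong (c * f x +_) (∑-*ˡ c xs f)) (sym (*-distribˡ-+ c (f x) (∑ xs f)))

  ∑-*ʳ : (c : ℕ) (xs : List A) (f : A → ℕ) → ∑[ x ← xs ] (f x * c) ≡ ∑ xs f * c
  ∑-*ʳ c []       f = refl
  ∑-*ʳ c (x ∷ xs) f =
    trans (cong (f x * c +_) (∑-*ʳ c xs f)) (sym (*-distribʳ-+ c (f x) (∑ xs f)))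

  ∑-++ : (xs ys : List A) (f : A → ℕ) → ∑ (xs ++ ys) f ≡ ∑ xs f + ∑ ys f
  ∑-++ []       ys f = refl
  ∑-++ (x ∷ xs) ys f = trans (cong (f x +_) (∑-++ xs ys f)) (sym (+-assoc (f x) (∑ xs f) (∑ ys f)))

  ≤-∑ : (xs : List A) {c : ℕ} {f : A → ℕ} → Any (λ x → c ≤ f x) xs → c ≤ ∑ xs f
  ≤-∑ (x ∷ xs) {f = f} (here c≤fx) = ≤-trans c≤fx (m≤m+n (f x) (∑ xs f))
  ≤-∑ (x ∷ xs) {f = f} (there c≤∑) = ≤-trans (≤-∑ xs c≤∑) (m≤n+m (∑ xs f) (f x))

  ∑-mono-≤-with-gap : (xs : List A) {c : ℕ} {f g : A → ℕ} → (∀ x → f x ≤ g x) →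
             Any (λ x → c + f x ≤ g x) xs → c + ∑ xs f ≤ ∑ xs g
  ∑-mono-≤-with-gap (x ∷ xs) {c} {f} {g} f≤g (here c+fx≤gx) = begin
    c + (f x + ∑ xs f) ≡⟨ +-assoc c (f x) (∑ xs f) ⟨
    c + f x + ∑ xs f   ≤⟨ +-mono-≤ c+fx≤gx (∑-mono-≤ xs f≤g) ⟩
    g x + ∑ xs g       ∎
    where open ≤-Reasoning
  ∑-mono-≤-with-gap (x ∷ xs) {c} {f} {g} f≤g (there gap) = begin
    c + (f x + ∑ xs f) ≡⟨ x∙yz≈y∙xz c (f x) (∑ xs f) ⟩
    f x + (c + ∑ xs f) ≤⟨ +-mono-≤ (f≤g x) (∑-mono-≤-with-gap xs f≤g gap) ⟩
    g x + ∑ xs g       ∎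
    where open ≤-Reasoning

  length-filter≡∑𝟙 : {P : A → Set} (P? : ∀ x → Dec (P x)) (xs : List A) →
                     length (filter P? xs) ≡ ∑[ x ← xs ] 𝟙 (P? x)
  length-filter≡∑𝟙 P? []       = refl
  length-filter≡∑𝟙 P? (x ∷ xs) with P? x
  ... | yes _ = cong suc (length-filter≡∑𝟙 P? xs)
  ... | no  _ = length-filter≡∑𝟙 P? xs

module _ {A B : Set} where

  ∑-map : (xs : List A) (g : A → B) (f : B → ℕ) → ∑ (map g xs) f ≡ ∑[ x ← xs ] f (g x)
  ∑-map []       g f = refl
  ∑-map (x ∷ xs) g f = cong (f (g x) +_) (∑-map xs g f)

  ∑-swap : (xs : List A) (ys : List B) (h : A → B → ℕ) →
           ∑[ x ← xs ] ∑[ y ← ys ] h x y ≡ ∑[ y ← ys ] ∑[ x ← xs ] h x y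
  ∑-swap []       ys h = sym (∑-zero ys (λ _ → refl))
  ∑-swap (x ∷ xs) ys h = trans (cong (∑ ys (h x) +_) (∑-swap xs ys h)) (sym (∑-+ ys (h x) _))

∑-cartesianProductWith : {A B C : Set} (g : A → B → C) (xs : List A) (ys : List B) (f : C → ℕ) →
  ∑ (cartesianProductWith g xs ys) f ≡ ∑[ x ← xs ] ∑[ y ← ys ] f (g x y)
∑-cartesianProductWith g []       ys f = refl
∑-cartesianProductWith g (x ∷ xs) ys f =
  trans (∑-++ (map (g x) ys) _ f) (cong₂ _+_ (∑-map ys (g x) f) (∑-cartesianProductWith g xs ys f))

𝟙-mono : {X Y : Set} (x? : Dec X) (y? : Dec Y) → (X → Y) → 𝟙 x? ≤ 𝟙 y?
𝟙-mono (yes x) (no ¬y) X→Y = ⊥-elim (¬y (X→Y x))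
𝟙-mono (yes _) (yes _) _   = ≤-refl
𝟙-mono (no _)  _       _   = z≤n

𝟙-cong : {X Y : Set} (x? : Dec X) (y? : Dec Y) → (X → Y) → (Y → X) → 𝟙 x? ≡ 𝟙 y?
𝟙-cong x? y? X→Y Y→X = ≤-antisym (𝟙-mono x? y? X→Y) (𝟙-mono y? x? Y→X)

𝟙-yes : {X : Set} (x? : Dec X) → X → 𝟙 x? ≡ 1
𝟙-yes (yes _) _ = refl
𝟙-yes (no ¬x) x = ⊥-elim (¬x x)

𝟙-no : {X : Set} (x? : Dec X) → ¬ X → 𝟙 x? ≡ 0
𝟙-no (yes x) ¬x = ⊥-elim (¬x x)
𝟙-no (no _)  _  = refl

𝟙≤1 : {X : Set} (x? : Dec X) → 𝟙 x? ≤ 1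
𝟙≤1 (yes _) = ≤-refl
𝟙≤1 (no _)  = z≤n

𝟙+𝟙¬≡1 : {X : Set} (x? : Dec X) → 𝟙 x? + 𝟙 (¬? x?) ≡ 1
𝟙+𝟙¬≡1 (yes _) = refl
𝟙+𝟙¬≡1 (no _)  = refl

concatMap-map≡cartesianProductWith : {A B C : Set} (f : A → B → C) (xs : List A) (ys : List B) →
  concatMap (λ x → map (f x) ys) xs ≡ cartesianProductWith f xs ys
concatMap-map≡cartesianProductWith f []       ys = refl
concatMap-map≡cartesianProductWith f (x ∷ xs) ys =
  cong (map (f x) ys ++_) (concatMap-map≡cartesianProductWith f xs ys)

module _ {A : Set} where

  allFuns-suc : (n : ℕ) (as : List A) →
    allFuns (suc n) as ≡ cartesianProductWith (λ g a → a Vector.∷ g) (allFuns n as) as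
  allFuns-suc n as = concatMap-map≡cartesianProductWith _ (allFuns n as) as

  ∑-allFuns-suc : (n : ℕ) (as : List A) (f : (Fin (suc n) → A) → ℕ) →
    ∑ (allFuns (suc n) as) f ≡ ∑[ g ← allFuns n as ] ∑[ a ← as ] f (a Vector.∷ g)
  ∑-allFuns-suc n as f =
    trans (cong (λ fs → ∑ fs f) (allFuns-suc n as)) (∑-cartesianProductWith _ (allFuns n as) as f)

  length-allFuns : (n : ℕ) (as : List A) → length (allFuns n as) ≡ length as ^ n
  length-allFuns zero    as = refl
  length-allFuns (suc n) as = begin
    length (allFuns (suc n) as)              ≡⟨ length≡∑1 (allFuns (suc n) as) ⟩
    ∑ (allFuns (suc n) as) (λ _ → 1)         ≡⟨ ∑-allFuns-suc n as _ ⟩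
    ∑[ g ← allFuns n as ] ∑ as (λ _ → 1)     ≡⟨ ∑-const (allFuns n as) _ ⟩
    length (allFuns n as) * ∑ as (λ _ → 1)   ≡⟨ cong₂ _*_ (length-allFuns n as) (sym (length≡∑1 as)) ⟩
    length as ^ n * length as                ≡⟨ *-comm (length as ^ n) (length as) ⟩
    length as ^ suc n                        ∎
    where open ≡-Reasoning

  ∈-allFuns⁻ : ∀ {n} {as : List A} {f} → f ∈ allFuns n as → ∀ i → f i ∈ as
  ∈-allFuns⁻ {suc n} {as} f∈ i
    with ∈-cartesianProductWith⁻ (λ g a → a Vector.∷ g) (allFuns n as) as
           (subst (_ ∈_) (allFuns-suc n as) f∈)
  ... | g , a , g∈ , a∈ , refl with i
  ...   | zero  = a∈
  ...   | suc j = ∈-allFuns⁻ g∈ j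

module _ {ℓ} (S : Setoid 0ℓ ℓ) where
  open Setoid S using (_≈_) renaming (Carrier to A)
  open SetoidMembership S using () renaming (_∈_ to _∈ₛ_)

  ∈-allFuns⁺ : ∀ {n} {as : List A} {f : Fin n → A} → (∀ i → f i ∈ₛ as) →
               SetoidMembership._∈_ (Pointwise.setoid S n) f (allFuns n as)
  ∈-allFuns⁺ {zero}           _  = here (λ ())
  ∈-allFuns⁺ {suc n} {as} {f} f∈ =
    SetoidMembershipₚ.∈-resp-≈ (Pointwise.setoid S (suc n)) head∷tail≈f
      (subst (SetoidMembership._∈_ (Pointwise.setoid S (suc n)) _) (sym (allFuns-suc n as))
        (SetoidMembershipₚ.∈-cartesianProductWith⁺ (Pointwise.setoid S n) S (Pointwise.setoid S (suc n))
          ∷-cong (∈-allFuns⁺ (f∈ ∘ suc)) (f∈ zero)))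
    where
    head∷tail≈f : ∀ i → (f zero Vector.∷ f ∘ suc) i ≈ f i
    head∷tail≈f zero    = Setoid.refl S
    head∷tail≈f (suc i) = Setoid.refl S
    ∷-cong : ∀ {g g′ a b} → (∀ i → g i ≈ g′ i) → a ≈ b → ∀ i → (a Vector.∷ g) i ≈ (b Vector.∷ g′) i
    ∷-cong g≈g′ a≈b zero    = a≈b
    ∷-cong g≈g′ a≈b (suc i) = g≈g′ i

  allFuns-unique : ∀ n {as : List A} → Unique S as → Unique (Pointwise.setoid S n) (allFuns n as)
  allFuns-unique zero    _          = All.[] ∷ []
  allFuns-unique (suc n) {as} as-! =
    subst (Unique (Pointwise.setoid S (suc n))) (sym (allFuns-suc n as))
      (Uniqueₚ.cartesianProductWith⁺ (Pointwise.setoid S n) S (Pointwise.setoid S (suc n)) _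
        (λ a∷g≈b∷g′ → a∷g≈b∷g′ ∘ suc , a∷g≈b∷g′ zero) (allFuns-unique n as-!) as-!)

-- Counting by injections

module _ {c ℓ} (S : Setoid c ℓ) where
  open Setoid S using (_≈_) renaming (sym to ≈-sym; trans to ≈-trans)
  open SetoidMembership S using () renaming (_∈_ to _∈ₛ_)

  ∈-─ : ∀ {x y ys} (x∈ys : x ∈ₛ ys) → y ∈ₛ ys → ¬ y ≈ x → y ∈ₛ (ys ─ x∈ys)
  ∈-─ (here x≈z)  (here y≈z)  y≉x = ⊥-elim (y≉x (≈-trans y≈z (≈-sym x≈z)))
  ∈-─ (here _)    (there y∈)  _   = y∈
  ∈-─ (there _)   (here y≈z)  _   = here y≈z
  ∈-─ (there x∈)  (there y∈)  y≉x = there (∈-─ x∈ y∈ y≉x)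

module _ {a b ℓ₁ ℓ₂} (A : Setoid a ℓ₁) (B : Setoid b ℓ₂) where
  open Setoid A using () renaming (Carrier to X; _≈_ to _≈₁_; sym to ≈₁-sym)
  open Setoid B using () renaming (Carrier to Y; _≈_ to _≈₂_)
  open SetoidMembership B using () renaming (_∈_ to _∈₂_)

  length-≤-by-injection : (f : X → Y) {xs : List X} {ys : List Y} → Unique A xs →
    (∀ {x y} → x ∈ xs → y ∈ xs → f x ≈₂ f y → x ≈₁ y) →
    (∀ {x} → x ∈ xs → f x ∈₂ ys) → length xs ≤ length ys
  length-≤-by-injection f {[]}     _             _   _   = z≤n
  length-≤-by-injection f {x ∷ xs} {ys} (x≉xs ∷ xs-!) inj img = begin
    suc (length xs)          ≤⟨ s≤s (length-≤-by-injection f xs-! (λ p q → inj (there p) (there q)) img′) ⟩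
    suc (length (ys ─ fx∈))  ≡⟨ length-removeAt′ ys (Any.index fx∈) ⟨
    length ys                ∎
    where
    open ≤-Reasoning
    fx∈ : f x ∈₂ ys
    fx∈ = img (here refl)
    img′ : ∀ {z} → z ∈ xs → f z ∈₂ (ys ─ fx∈)
    img′ z∈ = ∈-─ B fx∈ (img (there z∈))
      (λ fz≈fx → All.lookup x≉xs z∈ (≈₁-sym (inj (there z∈) (here refl) fz≈fx)))

-- Minimal elements of finite partial orders

module _ {n : ℕ} (R : BRel n) (R-isPartialOrder : IsPartialOrderB R) where
  private
    R-refl : ∀ x → R x x ≡ true
    R-refl = proj₁ R-isPartialOrder
    R-antisym : ∀ x y → R x y ≡ true → R y x ≡ true → x ≡ y
    R-antisym = proj₁ (proj₂ R-isPartialOrder)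
    R-trans : ∀ x y z → R x y ≡ true → R y z ≡ true → R x z ≡ true
    R-trans = proj₂ (proj₂ R-isPartialOrder)

  below : Fin n → ℕ
  below x = ∑[ y ← allFin n ] 𝟙 (R y x ≟ᵇ true)

  below-< : ∀ {x y} → R y x ≡ true → y ≢ x → below y < below x
  below-< {x} {y} Ryx y≢x =
    ∑-mono-≤-with-gap (allFin n) (λ z → 𝟙-mono (R z y ≟ᵇ true) (R z x ≟ᵇ true) (λ Rzy → R-trans z y x Rzy Ryx))
      (Any.map (λ { refl → x-gap }) (∈-allFin x))
    where
    x-gap : 1 + 𝟙 (R x y ≟ᵇ true) ≤ 𝟙 (R x x ≟ᵇ true)
    x-gap rewrite 𝟙-no (R x y ≟ᵇ true) (λ Rxy → y≢x (R-antisym y x Ryx Rxy))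
                | 𝟙-yes (R x x ≟ᵇ true) (R-refl x) = ≤-refl

  minimal-below : ∀ x → ∃[ y ] IsMinimal R y × R y x ≡ true
  minimal-below x = descend (suc (below x)) x ≤-refl
    where
    descend : ∀ fuel x → below x < fuel → ∃[ y ] IsMinimal R y × R y x ≡ true
    descend zero       x ()
    descend (suc fuel) x below<fuel with any? (λ y → (R y x ≟ᵇ true) ×-dec ¬? (y ≟ᶠ x))
    ... | yes (y , Ryx , y≢x) =
      let z , z-minimal , Rzy = descend fuel y (<-≤-trans (below-< Ryx y≢x) (s≤s⁻¹ below<fuel))
      in  z , z-minimal , R-trans z y x Rzy Ryx
    ... | no ∄y = x , (λ y Ryx → decidable-stable (y ≟ᶠ x) (λ y≢x → ∄y (y , Ryx , y≢x))) , R-refl x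

-- Subsets of Fin n and coverings

true≢false : true ≢ false
true≢false ()

_∩_ : ∀ {n} → (Fin n → Bool) → (Fin n → Bool) → Fin n → Bool
(S ∩ T) x = S x ∧ T x

_⊆_ : ∀ {n} → (Fin n → Bool) → (Fin n → Bool) → Set
S ⊆ T = ∀ x → S x ≡ true → T x ≡ true

Empty : ∀ {n} → (Fin n → Bool) → Set
Empty S = ∀ x → S x ≡ false

NonEmpty : ∀ {n} → (Fin n → Bool) → Set
NonEmpty S = ∃[ x ] S x ≡ true

nonEmpty? : ∀ {n} (S : Fin n → Bool) → Dec (NonEmpty S)
nonEmpty? S = any? (λ x → S x ≟ᵇ true)

∩-true⁻ : ∀ {n} (S T : Fin n → Bool) x → (S ∩ T) x ≡ true → S x ≡ true × T x ≡ true
∩-true⁻ S T x Sx∧Tx with S x | T x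
∩-true⁻ S T x refl | true | true = refl , refl

∩-⊆ˡ : ∀ {n} (S T : Fin n → Bool) → (S ∩ T) ⊆ S
∩-⊆ˡ S T x = proj₁ ∘ ∩-true⁻ S T x

∩-emptyʳ : ∀ {n} (S : Fin n → Bool) {T} → Empty T → Empty (S ∩ T)
∩-emptyʳ S T-empty x = trans (cong (S x ∧_) (T-empty x)) (∧-zeroʳ (S x))

empty⇒¬nonEmpty : ∀ {n} {S : Fin n → Bool} → Empty S → ¬ NonEmpty S
empty⇒¬nonEmpty S-empty (x , Sx) = true≢false (trans (sym Sx) (S-empty x))

¬nonEmpty⇒empty : ∀ {n} {S : Fin n → Bool} → ¬ NonEmpty S → Empty S
¬nonEmpty⇒empty ∄x x = ¬-not (λ Sx → ∄x (x , Sx))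

K : ∀ {k} → Fin k → Bool
K _ = true

Covering : ∀ {m k} → (Fin k → Bool) → (Fin m → Fin k → Bool) → Set
Covering S t = ∀ x → S x ≡ true → ∃[ i ] t i x ≡ false

covering? : ∀ {m k} (S : Fin k → Bool) (t : Fin m → Fin k → Bool) → Dec (Covering S t)
covering? S t = all? λ x → (S x ≟ᵇ true) →-dec any? (λ i → t i x ≟ᵇ false)

module _ {m k} {S a : Fin k → Bool} {t : Fin m → Fin k → Bool} where

  covering-∷⁻ : Covering S (a Vector.∷ t) → Covering (S ∩ a) t
  covering-∷⁻ cov x Sx∧ax with cov x (proj₁ (∩-true⁻ S a x Sx∧ax))
  ... | zero  , ax≡false  = ⊥-elim (true≢false (trans (sym (proj₂ (∩-true⁻ S a x Sx∧ax))) ax≡false))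
  ... | suc i , tix≡false = i , tix≡false

  covering-∷⁺ : Covering (S ∩ a) t → Covering S (a Vector.∷ t)
  covering-∷⁺ cov x Sx with a x in ax
  ... | false = zero , ax
  ... | true  = let i , tix≡false = cov x (cong₂ _∧_ Sx ax) in suc i , tix≡false

-- Extensions of P as tuples of downsets

data Side (m k : ℕ) : Fin (m + k) → Set where
  inM : (a : Fin m) → Side m k (a ↑ˡ k)
  inK : (j : Fin k) → Side m k (m ↑ʳ j)

side : ∀ m {k} (x : Fin (m + k)) → Side m k x
side m {k} x with splitAt m x in split≡
... | inj₁ a = subst (Side m k) (splitAt⁻¹-↑ˡ split≡) (inM a)
... | inj₂ j = subst (Side m k) (splitAt⁻¹-↑ʳ split≡) (inK j)

toℕ-↑ˡ< : ∀ {m} k (a : Fin m) → toℕ (a ↑ˡ k) < m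
toℕ-↑ˡ< k a = subst (_< _) (sym (toℕ-↑ˡ a k)) (toℕ<n a)

toℕ-↑ʳ≮ : ∀ m {k} (j : Fin k) → ¬ toℕ (m ↑ʳ j) < m
toℕ-↑ʳ≮ m j = m+n≮m m (toℕ j) ∘ subst (_< m) (toℕ-↑ʳ m j)

↑ʳ≢↑ˡ : ∀ {m k} (j : Fin k) (a : Fin m) → m ↑ʳ j ≢ a ↑ˡ k
↑ʳ≢↑ˡ {m} {k} j a j≡a = toℕ-↑ʳ≮ m j (subst (λ x → toℕ x < m) (sym j≡a) (toℕ-↑ˡ< k a))

splitAt-injective : ∀ m {k} (x y : Fin (m + k)) → splitAt m x ≡ splitAt m y → x ≡ y
splitAt-injective m {k} x y eq =
  trans (sym (join-splitAt m k x)) (trans (cong (join m k) eq) (join-splitAt m k y))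

Subsets : ℕ → Setoid 0ℓ 0ℓ
Subsets = Pointwise.setoid (setoid Bool)

Matrices : ℕ → ℕ → Setoid 0ℓ 0ℓ
Matrices m n = Pointwise.setoid (Subsets n) m

infix 4 _∈ₛ_ _∈ₘ_

_∈ₛ_ : ∀ {n} → (Fin n → Bool) → List (Fin n → Bool) → Set
S ∈ₛ Ss = SetoidMembership._∈_ (Subsets _) S Ss

_∈ₘ_ : ∀ {m n} → (Fin m → Fin n → Bool) → List (Fin m → Fin n → Bool) → Set
t ∈ₘ ts = SetoidMembership._∈_ (Matrices _ _) t ts

∈-bools : (b : Bool) → b ∈ bools
∈-bools true  = here refl
∈-bools false = there (here refl)

allSubsets-unique : ∀ n → Unique (Subsets n) (allSubsets n)
allSubsets-unique n = allFuns-unique (setoid Bool) n (((λ ()) All.∷ All.[]) ∷ All.[] ∷ [])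

∈-allSubsets : ∀ {n} (S : Fin n → Bool) → S ∈ₛ allSubsets n
∈-allSubsets S = ∈-allFuns⁺ (setoid Bool) (∈-bools ∘ S)

allBRels-unique : ∀ n → Unique (Matrices n n) (allBRels n)
allBRels-unique n = allFuns-unique (Subsets n) n (allSubsets-unique n)

∈-allBRels : ∀ {n} (R : BRel n) → R ∈ₘ allBRels n
∈-allBRels R = ∈-allFuns⁺ (Subsets _) (∈-allSubsets ∘ R)

covering-resp : ∀ {m k} {S : Fin k → Bool} {t t′ : Fin m → Fin k → Bool} →
                (∀ i x → t i x ≡ t′ i x) → Covering S t → Covering S t′
covering-resp t≈t′ cov x Sx = let i , tix≡false = cov x Sx in i , trans (sym (t≈t′ i x)) tix≡false

module _ {k : ℕ} (P : FinPoset k) where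
  open FinPoset P using () renaming (_≤ₚ_ to _⊑_)
  private
    ⊑-refl : ∀ i → i ⊑ i ≡ true
    ⊑-refl = proj₁ (isPO P)
    ⊑-antisym : ∀ i j → i ⊑ j ≡ true → j ⊑ i ≡ true → i ≡ j
    ⊑-antisym = proj₁ (proj₂ (isPO P))
    ⊑-trans : ∀ i j l → i ⊑ j ≡ true → j ⊑ l ≡ true → i ⊑ l ≡ true
    ⊑-trans = proj₂ (proj₂ (isPO P))

  isDownset-resp : ∀ {S S′} → (∀ x → S x ≡ S′ x) → IsDownset P S → IsDownset P S′
  isDownset-resp S≈S′ S-down x y x⊑y S′y = trans (sym (S≈S′ x)) (S-down x y x⊑y (trans (S≈S′ y) S′y))

  isExtension-resp : ∀ {m} {R R′ : BRel (m + k)} → (∀ x y → R x y ≡ R′ x y) →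
                     IsExtension m P R → IsExtension m P R′
  isExtension-resp R≈R′ ((refl′ , antisym , trans′) , restrict , minimal⇒inM , inM⇒minimal) =
    ((λ x → trans (sym (R≈R′ x x)) (refl′ x)) ,
     (λ x y p q → antisym x y (trans (R≈R′ x y) p) (trans (R≈R′ y x) q)) ,
     (λ x y z p q → trans (sym (R≈R′ x z)) (trans′ x y z (trans (R≈R′ x y) p) (trans (R≈R′ y z) q)))) ,
    (λ i j → trans (sym (R≈R′ _ _)) (restrict i j)) ,
    (λ x x-min → minimal⇒inM x (λ y Ryx → x-min y (trans (sym (R≈R′ y x)) Ryx))) ,
    (λ x x∈M y R′yx → inM⇒minimal x x∈M y (trans (R≈R′ y x) R′yx))

  ⊎-order : ∀ {m} → (Fin m → Fin k → Bool) → Fin m ⊎ Fin k → Fin m ⊎ Fin k → Bool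
  ⊎-order t (inj₁ a) (inj₁ b) = does (a ≟ᶠ b)
  ⊎-order t (inj₁ a) (inj₂ j) = not (t a j)
  ⊎-order t (inj₂ i) (inj₁ b) = false
  ⊎-order t (inj₂ i) (inj₂ j) = i ⊑ j

  toRelation : ∀ m → (Fin m → Fin k → Bool) → BRel (m + k)
  toRelation m t x y = ⊎-order t (splitAt m x) (splitAt m y)

  toTuple : ∀ m → BRel (m + k) → Fin m → Fin k → Bool
  toTuple m R a j = not (R (a ↑ˡ k) (m ↑ʳ j))

  ⊎-order-cong : ∀ {m} {t t′ : Fin m → Fin k → Bool} → (∀ a j → t a j ≡ t′ a j) →
                 ∀ u v → ⊎-order t u v ≡ ⊎-order t′ u v
  ⊎-order-cong t≈t′ (inj₁ a) (inj₂ j) = cong not (t≈t′ a j)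
  ⊎-order-cong t≈t′ (inj₁ a) (inj₁ b) = refl
  ⊎-order-cong t≈t′ (inj₂ i) (inj₁ b) = refl
  ⊎-order-cong t≈t′ (inj₂ i) (inj₂ j) = refl

  module _ {m} (t : Fin m → Fin k → Bool) where

    toRelation-MM : ∀ a b → toRelation m t (a ↑ˡ k) (b ↑ˡ k) ≡ does (a ≟ᶠ b)
    toRelation-MM a b = cong₂ (⊎-order t) (splitAt-↑ˡ m a k) (splitAt-↑ˡ m b k)

    toRelation-MK : ∀ a j → toRelation m t (a ↑ˡ k) (m ↑ʳ j) ≡ not (t a j)
    toRelation-MK a j = cong₂ (⊎-order t) (splitAt-↑ˡ m a k) (splitAt-↑ʳ m k j)

    toRelation-KM : ∀ i b → toRelation m t (m ↑ʳ i) (b ↑ˡ k) ≡ false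
    toRelation-KM i b = cong₂ (⊎-order t) (splitAt-↑ʳ m k i) (splitAt-↑ˡ m b k)

    toRelation-KK : ∀ i j → toRelation m t (m ↑ʳ i) (m ↑ʳ j) ≡ i ⊑ j
    toRelation-KK i j = cong₂ (⊎-order t) (splitAt-↑ʳ m k i) (splitAt-↑ʳ m k j)

    toTuple∘toRelation : ∀ a j → toTuple m (toRelation m t) a j ≡ t a j
    toTuple∘toRelation a j = trans (cong not (toRelation-MK a j)) (not-involutive (t a j))

  module _ {m} {t : Fin m → Fin k → Bool} (t-downsets : ∀ a → IsDownset P (t a)) where

    ⊎-order-refl : ∀ u → ⊎-order t u u ≡ true
    ⊎-order-refl (inj₁ a) = dec-true (a ≟ᶠ a) refl
    ⊎-order-refl (inj₂ i) = ⊑-refl i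

    ⊎-order-antisym : ∀ u v → ⊎-order t u v ≡ true → ⊎-order t v u ≡ true → u ≡ v
    ⊎-order-antisym (inj₁ a) (inj₁ b) a≤b _ with a ≟ᶠ b
    ⊎-order-antisym (inj₁ a) (inj₁ b) _  _ | yes a≡b = cong inj₁ a≡b
    ⊎-order-antisym (inj₁ a) (inj₁ b) () _ | no _
    ⊎-order-antisym (inj₂ i) (inj₂ j) i⊑j j⊑i = cong inj₂ (⊑-antisym i j i⊑j j⊑i)
    ⊎-order-antisym (inj₁ a) (inj₂ j) _  ()
    ⊎-order-antisym (inj₂ i) (inj₁ b) ()  _

    ⊎-order-trans : ∀ u v w → ⊎-order t u v ≡ true → ⊎-order t v w ≡ true → ⊎-order t u w ≡ true
    ⊎-order-trans (inj₁ a) (inj₁ b) w a≤b b≤w with a ≟ᶠ b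
    ⊎-order-trans (inj₁ a) (inj₁ _) w _ a≤w | yes refl = a≤w
    ⊎-order-trans (inj₁ a) (inj₁ b) w () _  | no _
    ⊎-order-trans (inj₁ a) (inj₂ i) (inj₂ j) a≤i i⊑j with t a j in taj
    ... | false = refl
    ... | true  = trans (cong not (sym (t-downsets a i j i⊑j taj))) a≤i
    ⊎-order-trans (inj₂ i) (inj₂ j) (inj₂ l) i⊑j j⊑l = ⊑-trans i j l i⊑j j⊑l
    ⊎-order-trans (inj₁ a) (inj₂ i) (inj₁ c) _ ()
    ⊎-order-trans (inj₂ i) (inj₁ b) w        () _
    ⊎-order-trans (inj₂ i) (inj₂ j) (inj₁ c) _ ()

    toRelation-isPartialOrder : IsPartialOrderB (toRelation m t)
    toRelation-isPartialOrder =
      (λ x → ⊎-order-refl (splitAt m x)) ,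
      (λ x y p q → splitAt-injective m x y (⊎-order-antisym (splitAt m x) (splitAt m y) p q)) ,
      (λ x y z → ⊎-order-trans (splitAt m x) (splitAt m y) (splitAt m z))

    toRelation-isExtension : Covering K t → IsExtension m P (toRelation m t)
    toRelation-isExtension cov = toRelation-isPartialOrder , toRelation-KK t , minimal⇒inM , inM⇒minimal
      where
      minimal⇒inM : ∀ x → IsMinimal (toRelation m t) x → toℕ x < m
      minimal⇒inM x x-min with side m x
      ... | inM a = toℕ-↑ˡ< k a
      ... | inK j with cov j refl
      ...   | a , taj = ⊥-elim (↑ʳ≢↑ˡ j a (sym (x-min (a ↑ˡ k) (trans (toRelation-MK t a j) (cong not taj)))))
      inM⇒minimal : ∀ x → toℕ x < m → IsMinimal (toRelation m t) x
      inM⇒minimal x x∈M y y≤x with side m x | side m y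
      ... | inK j | _     = ⊥-elim (toℕ-↑ʳ≮ m j x∈M)
      ... | inM a | inK i = ⊥-elim (true≢false (trans (sym y≤x) (toRelation-KM t i a)))
      ... | inM a | inM b with b ≟ᶠ a | trans (sym (toRelation-MM t b a)) y≤x
      ...   | yes refl | _ = refl
      ...   | no _     | ()

  module _ {m} {R : BRel (m + k)} (R-isExtension : IsExtension m P R) where
    private
      R-isPartialOrder = proj₁ R-isExtension
      R-refl = proj₁ R-isPartialOrder
      R-trans = proj₂ (proj₂ R-isPartialOrder)
      R-restrict = proj₁ (proj₂ R-isExtension)
      R-minimal⇒inM = proj₁ (proj₂ (proj₂ R-isExtension))
      R-inM⇒minimal = proj₂ (proj₂ (proj₂ R-isExtension))

    toTuple-downsets : ∀ a → IsDownset P (toTuple m R a)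
    toTuple-downsets a i j i⊑j taj with R (a ↑ˡ k) (m ↑ʳ i) in a≤i
    ... | false = refl
    ... | true  = trans (cong not (sym (R-trans _ _ _ a≤i (trans (R-restrict i j) i⊑j)))) taj

    toTuple-covering : Covering K (toTuple m R)
    toTuple-covering j _ with minimal-below R R-isPartialOrder (m ↑ʳ j)
    ... | y , y-minimal , y≤j with side m y
    ...   | inM a = a , cong not y≤j
    ...   | inK i = ⊥-elim (toℕ-↑ʳ≮ m i (R-minimal⇒inM (m ↑ʳ i) y-minimal))

    toRelation∘toTuple : ∀ x y → toRelation m (toTuple m R) x y ≡ R x y
    toRelation∘toTuple x y with side m x | side m y
    ... | inM a | inM b = trans (toRelation-MM (toTuple m R) a b) (sym (M-antichain a b))
      where
      M-antichain : ∀ a b → R (a ↑ˡ k) (b ↑ˡ k) ≡ does (a ≟ᶠ b)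
      M-antichain a b with a ≟ᶠ b
      ... | yes refl = R-refl _
      ... | no a≢b with R (a ↑ˡ k) (b ↑ˡ k) in a≤b
      ...   | false = refl
      ...   | true  = ⊥-elim (a≢b (↑ˡ-injective k a b (R-inM⇒minimal _ (toℕ-↑ˡ< k b) _ a≤b)))
    ... | inM a | inK j = trans (toRelation-MK (toTuple m R) a j) (not-involutive _)
    ... | inK i | inM b = trans (toRelation-KM (toTuple m R) i b) (sym K≰M)
      where
      K≰M : R (m ↑ʳ i) (b ↑ˡ k) ≡ false
      K≰M with R (m ↑ʳ i) (b ↑ˡ k) in i≤b
      ... | false = refl
      ... | true  = ⊥-elim (↑ʳ≢↑ˡ i b (R-inM⇒minimal _ (toℕ-↑ˡ< k b) _ i≤b))
    ... | inK i | inK j = trans (toRelation-KK (toTuple m R) i j) (sym (R-restrict i j))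

  toTuple-injective : ∀ {m} {R R′ : BRel (m + k)} → IsExtension m P R → IsExtension m P R′ →
                      (∀ a j → toTuple m R a j ≡ toTuple m R′ a j) → ∀ x y → R x y ≡ R′ x y
  toTuple-injective {m} {R} {R′} R-ext R′-ext R≈R′ x y = begin
    R x y                           ≡⟨ toRelation∘toTuple R-ext x y ⟨
    toRelation m (toTuple m R) x y  ≡⟨ ⊎-order-cong R≈R′ (splitAt m x) (splitAt m y) ⟩
    toRelation m (toTuple m R′) x y ≡⟨ toRelation∘toTuple R′-ext x y ⟩
    R′ x y                          ∎
    where open ≡-Reasoning

  toRelation-injective : ∀ {m} (t t′ : Fin m → Fin k → Bool) →
    (∀ x y → toRelation m t x y ≡ toRelation m t′ x y) → ∀ a j → t a j ≡ t′ a j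
  toRelation-injective {m} t t′ t≈t′ a j = begin
    t a j                                   ≡⟨ toTuple∘toRelation t a j ⟨
    not (toRelation m t (a ↑ˡ k) (m ↑ʳ j))  ≡⟨ cong not (t≈t′ (a ↑ˡ k) (m ↑ʳ j)) ⟩
    not (toRelation m t′ (a ↑ˡ k) (m ↑ʳ j)) ≡⟨ toTuple∘toRelation t′ a j ⟩
    t′ a j                                  ∎
    where open ≡-Reasoning

  downsets : List (Fin k → Bool)
  downsets = filter (isDownset? P) (allSubsets k)

  tuples : ∀ m → List (Fin m → Fin k → Bool)
  tuples m = allFuns m downsets

  extensions : ∀ m → List (BRel (m + k))
  extensions m = filter (isExtension? m P) (allBRels (m + k))

  coveringTuples : ∀ m → List (Fin m → Fin k → Bool)
  coveringTuples m = filter (covering? K) (tuples m)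

  ∈-downsets⁺ : ∀ {S} → IsDownset P S → S ∈ₛ downsets
  ∈-downsets⁺ {S} = SetoidMembershipₚ.∈-filter⁺ (Subsets k) (isDownset? P) isDownset-resp (∈-allSubsets S)

  ∈-tuples⁺ : ∀ {m} {t : Fin m → Fin k → Bool} → (∀ a → IsDownset P (t a)) → t ∈ₘ tuples m
  ∈-tuples⁺ t-downsets = ∈-allFuns⁺ (Subsets k) (∈-downsets⁺ ∘ t-downsets)

  ∈-tuples⁻ : ∀ {m} {t : Fin m → Fin k → Bool} → t ∈ tuples m → ∀ a → IsDownset P (t a)
  ∈-tuples⁻ t∈ a = proj₂ (∈-filter⁻ (isDownset? P) {xs = allSubsets k} (∈-allFuns⁻ t∈ a))

  tuples-unique : ∀ m → Unique (Matrices m k) (tuples m)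
  tuples-unique m = allFuns-unique (Subsets k) m (Uniqueₚ.filter⁺ (Subsets k) (isDownset? P) (allSubsets-unique k))

  #extensions≤#coveringTuples : ∀ m → length (extensions m) ≤ length (coveringTuples m)
  #extensions≤#coveringTuples m =
    length-≤-by-injection (Matrices (m + k) (m + k)) (Matrices m k) (toTuple m)
      (Uniqueₚ.filter⁺ (Matrices (m + k) (m + k)) (isExtension? m P) (allBRels-unique (m + k)))
      (λ R∈ R′∈ → toTuple-injective (isExt R∈) (isExt R′∈))
      (λ R∈ → SetoidMembershipₚ.∈-filter⁺ (Matrices m k) (covering? K) covering-resp
        (∈-tuples⁺ (toTuple-downsets (isExt R∈))) (toTuple-covering (isExt R∈)))
    where
    isExt : ∀ {R} → R ∈ extensions m → IsExtension m P R
    isExt = proj₂ ∘ ∈-filter⁻ (isExtension? m P) {xs = allBRels (m + k)}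

  #coveringTuples≤#extensions : ∀ m → length (coveringTuples m) ≤ length (extensions m)
  #coveringTuples≤#extensions m =
    length-≤-by-injection (Matrices m k) (Matrices (m + k) (m + k)) (toRelation m)
      (Uniqueₚ.filter⁺ (Matrices m k) (covering? K) (tuples-unique m))
      (λ {t} {t′} _ _ → toRelation-injective t t′)
      (λ t∈ → let t∈tuples , t-covering = ∈-filter⁻ (covering? K) {xs = tuples m} t∈ in
        SetoidMembershipₚ.∈-filter⁺ (Matrices (m + k) (m + k)) (isExtension? m P) isExtension-resp
          (∈-allBRels _) (toRelation-isExtension (∈-tuples⁻ t∈tuples) t-covering))

  -- Counting covering tuples

  #cov : (Fin k → Bool) → ℕ → ℕ
  #cov S m = ∑[ t ← tuples m ] 𝟙 (covering? S t)

  #uncov : (Fin k → Bool) → ℕ → ℕ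
  #uncov S m = ∑[ t ← tuples m ] 𝟙 (¬? (covering? S t))

  #meet : (Fin k → Bool) → ℕ
  #meet S = ∑[ a ← downsets ] 𝟙 (nonEmpty? (S ∩ a))

  e≡#cov : ∀ m → e m P ≡ #cov K m
  e≡#cov m = trans (≤-antisym (#extensions≤#coveringTuples m) (#coveringTuples≤#extensions m))
                   (length-filter≡∑𝟙 (covering? K) (tuples m))

  ∅-downset : Any Empty downsets
  ∅-downset = Any.map (λ ∅≈a x → sym (∅≈a x)) (∈-downsets⁺ {S = λ _ → false} (λ _ _ _ ∅y → ∅y))

  d>0 : 0 < d P
  d>0 = subst (0 <_) (sym (length≡∑1 downsets)) (≤-∑ downsets (Any.map (λ _ → ≤-refl) ∅-downset))

  d^m>0 : ∀ m → 0 < d P ^ m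
  d^m>0 = m^n>0 (d P) {{>-nonZero d>0}}

  d≤2^k : d P ≤ 2 ^ k
  d≤2^k = subst (d P ≤_) (length-allFuns k bools) (length-filter-≤ (isDownset? P) (allSubsets k))

  #cov+#uncov≡d^m : ∀ S m → #cov S m + #uncov S m ≡ d P ^ m
  #cov+#uncov≡d^m S m = begin
    #cov S m + #uncov S m                                            ≡⟨ ∑-+ (tuples m) _ _ ⟨
    ∑[ t ← tuples m ] (𝟙 (covering? S t) + 𝟙 (¬? (covering? S t)))  ≡⟨ ∑-cong (tuples m) (𝟙+𝟙¬≡1 ∘ covering? S) ⟩
    ∑ (tuples m) (λ _ → 1)                                           ≡⟨ length≡∑1 (tuples m) ⟨
    length (tuples m)                                                ≡⟨ length-allFuns m downsets ⟩
    d P ^ m                                                          ∎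
    where open ≡-Reasoning

  #cov≤d^m : ∀ S m → #cov S m ≤ d P ^ m
  #cov≤d^m S m = subst (#cov S m ≤_) (#cov+#uncov≡d^m S m) (m≤m+n (#cov S m) (#uncov S m))

  #uncov≤d^m : ∀ S m → #uncov S m ≤ d P ^ m
  #uncov≤d^m S m = subst (#uncov S m ≤_) (#cov+#uncov≡d^m S m) (m≤n+m (#uncov S m) (#cov S m))

  #uncov-empty : ∀ {S} m → Empty S → #uncov S m ≡ 0
  #uncov-empty {S} m S-empty = ∑-zero (tuples m) λ t → 𝟙-no (¬? (covering? S t))
    (λ ¬covering → ¬covering (λ x Sx → ⊥-elim (empty⇒¬nonEmpty S-empty (x , Sx))))

  #cov-empty : ∀ {S} m → Empty S → #cov S m ≡ d P ^ m
  #cov-empty {S} m S-empty = begin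
    #cov S m              ≡⟨ +-identityʳ (#cov S m) ⟨
    #cov S m + 0          ≡⟨ cong (#cov S m +_) (#uncov-empty m S-empty) ⟨
    #cov S m + #uncov S m ≡⟨ #cov+#uncov≡d^m S m ⟩
    d P ^ m               ∎
    where open ≡-Reasoning

  #cov-antitone : ∀ {S T} m → S ⊆ T → #cov T m ≤ #cov S m
  #cov-antitone {S} {T} m S⊆T = ∑-mono-≤ (tuples m) λ t →
    𝟙-mono (covering? T t) (covering? S t) (λ T-covering x Sx → T-covering x (S⊆T x Sx))

  #meet-empty : ∀ {S} → Empty S → #meet S ≡ 0
  #meet-empty {S} S-empty = ∑-zero downsets λ a → 𝟙-no (nonEmpty? (S ∩ a))
    (λ (x , Sx∧ax) → empty⇒¬nonEmpty S-empty (x , proj₁ (∩-true⁻ S a x Sx∧ax)))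

  #meet-mono : ∀ {S T} → S ⊆ T → #meet S ≤ #meet T
  #meet-mono {S} {T} S⊆T = ∑-mono-≤ downsets λ a → 𝟙-mono (nonEmpty? (S ∩ a)) (nonEmpty? (T ∩ a))
    (λ (x , Sx∧ax) → x , cong₂ _∧_ (S⊆T x (proj₁ (∩-true⁻ S a x Sx∧ax))) (proj₂ (∩-true⁻ S a x Sx∧ax)))

  #meet<d : ∀ S → #meet S < d P
  #meet<d S = subst (#meet S <_) (sym (length≡∑1 downsets))
    (∑-mono-≤-with-gap downsets (𝟙≤1 ∘ nonEmpty? ∘ (S ∩_)) (Any.map ∅-gap ∅-downset))
    where
    ∅-gap : ∀ {a} → Empty a → 1 + 𝟙 (nonEmpty? (S ∩ a)) ≤ 1
    ∅-gap {a} a-empty = ≤-reflexive (cong suc (𝟙-no (nonEmpty? (S ∩ a)) (empty⇒¬nonEmpty (∩-emptyʳ S a-empty))))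

  #cov-suc : ∀ S m → #cov S (suc m) ≡ ∑[ a ← downsets ] #cov (S ∩ a) m
  #cov-suc S m = begin
    #cov S (suc m)
      ≡⟨ ∑-allFuns-suc m downsets _ ⟩
    ∑[ t ← tuples m ] ∑[ a ← downsets ] 𝟙 (covering? S (a Vector.∷ t))
      ≡⟨ ∑-cong (tuples m) (λ t → ∑-cong downsets λ a →
           𝟙-cong (covering? S (a Vector.∷ t)) (covering? (S ∩ a) t) covering-∷⁻ covering-∷⁺) ⟩
    ∑[ t ← tuples m ] ∑[ a ← downsets ] 𝟙 (covering? (S ∩ a) t)
      ≡⟨ ∑-swap (tuples m) downsets _ ⟩
    ∑[ a ← downsets ] #cov (S ∩ a) m
      ∎
    where open ≡-Reasoning

  #uncov-suc : ∀ S m → #uncov S (suc m) ≡ ∑[ a ← downsets ] #uncov (S ∩ a) m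
  #uncov-suc S m = begin
    #uncov S (suc m)
      ≡⟨ ∑-allFuns-suc m downsets _ ⟩
    ∑[ t ← tuples m ] ∑[ a ← downsets ] 𝟙 (¬? (covering? S (a Vector.∷ t)))
      ≡⟨ ∑-cong (tuples m) (λ t → ∑-cong downsets λ a →
           𝟙-cong (¬? (covering? S (a Vector.∷ t))) (¬? (covering? (S ∩ a) t))
             (λ ¬cov → ¬cov ∘ covering-∷⁺) (λ ¬cov → ¬cov ∘ covering-∷⁻)) ⟩
    ∑[ t ← tuples m ] ∑[ a ← downsets ] 𝟙 (¬? (covering? (S ∩ a) t))
      ≡⟨ ∑-swap (tuples m) downsets _ ⟩
    ∑[ a ← downsets ] #uncov (S ∩ a) m
      ∎
    where open ≡-Reasoning

  #uncov≤d^m*𝟙 : ∀ S m → #uncov S m ≤ d P ^ m * 𝟙 (nonEmpty? S)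
  #uncov≤d^m*𝟙 S m with nonEmpty? S
  ... | yes _ = subst (#uncov S m ≤_) (sym (*-identityʳ (d P ^ m))) (#uncov≤d^m S m)
  ... | no ∄x = ≤-trans (≤-reflexive (#uncov-empty m (¬nonEmpty⇒empty ∄x))) z≤n

  m*#uncov≤#cov*#meet : ∀ m S → m * #uncov S m ≤ #cov S m * #meet S
  m*#uncov≤#cov*#meet zero    S = z≤n
  m*#uncov≤#cov*#meet (suc m) S = begin
    #uncov S (suc m) + m * #uncov S (suc m)
      ≤⟨ +-mono-≤ uncov-bound induction-bound ⟩
    d P ^ m * #meet S + ∑[ a ← downsets ] (#cov (S ∩ a) m * #meet (S ∩ a))
      ≤⟨ ∑-mono-≤-with-gap downsets (λ a → *-monoʳ-≤ (#cov (S ∩ a) m) (#meet-mono (∩-⊆ˡ S a))) (Any.map ∅-gap ∅-downset) ⟩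
    ∑[ a ← downsets ] (#cov (S ∩ a) m * #meet S)
      ≡⟨ ∑-*ʳ (#meet S) downsets _ ⟩
    (∑[ a ← downsets ] #cov (S ∩ a) m) * #meet S
      ≡⟨ cong (_* #meet S) (#cov-suc S m) ⟨
    #cov S (suc m) * #meet S
      ∎
    where
    open ≤-Reasoning
    uncov-bound : #uncov S (suc m) ≤ d P ^ m * #meet S
    uncov-bound = begin
      #uncov S (suc m)                                     ≡⟨ #uncov-suc S m ⟩
      ∑[ a ← downsets ] #uncov (S ∩ a) m                   ≤⟨ ∑-mono-≤ downsets (λ a → #uncov≤d^m*𝟙 (S ∩ a) m) ⟩
      ∑[ a ← downsets ] (d P ^ m * 𝟙 (nonEmpty? (S ∩ a)))  ≡⟨ ∑-*ˡ (d P ^ m) downsets _ ⟩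
      d P ^ m * #meet S                                    ∎
    induction-bound : m * #uncov S (suc m) ≤ ∑[ a ← downsets ] (#cov (S ∩ a) m * #meet (S ∩ a))
    induction-bound = begin
      m * #uncov S (suc m)                     ≡⟨ cong (m *_) (#uncov-suc S m) ⟩
      m * ∑[ a ← downsets ] #uncov (S ∩ a) m   ≡⟨ ∑-*ˡ m downsets _ ⟨
      ∑[ a ← downsets ] (m * #uncov (S ∩ a) m) ≤⟨ ∑-mono-≤ downsets (λ a → m*#uncov≤#cov*#meet m (S ∩ a)) ⟩
      ∑[ a ← downsets ] (#cov (S ∩ a) m * #meet (S ∩ a)) ∎
    ∅-gap : ∀ {a} → Empty a → d P ^ m * #meet S + #cov (S ∩ a) m * #meet (S ∩ a) ≤ #cov (S ∩ a) m * #meet S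
    ∅-gap {a} a-empty = ≤-reflexive (begin-equality
      d P ^ m * #meet S + #cov (S ∩ a) m * #meet (S ∩ a) ≡⟨ cong₂ (λ x y → d P ^ m * #meet S + x * y)
                                                              (#cov-empty m S∩a-empty) (#meet-empty S∩a-empty) ⟩
      d P ^ m * #meet S + d P ^ m * 0                     ≡⟨ cong (d P ^ m * #meet S +_) (*-zeroʳ (d P ^ m)) ⟩
      d P ^ m * #meet S + 0                               ≡⟨ +-identityʳ _ ⟩
      d P ^ m * #meet S                                   ≡⟨ cong (_* #meet S) (#cov-empty m S∩a-empty) ⟨
      #cov (S ∩ a) m * #meet S                            ∎)
      where
      S∩a-empty : Empty (S ∩ a)
      S∩a-empty = ∩-emptyʳ S a-empty

  #cov-suc>0 : ∀ S m → 0 < #cov S (suc m)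
  #cov-suc>0 S m = subst (0 <_) (sym (#cov-suc S m)) (≤-∑ downsets (Any.map ∅-term ∅-downset))
    where
    ∅-term : ∀ {a} → Empty a → 0 < #cov (S ∩ a) m
    ∅-term a-empty = subst (0 <_) (sym (#cov-empty m (∩-emptyʳ S a-empty))) (d^m>0 m)

  d*#cov≤#cov-suc : ∀ S m → d P * #cov S m ≤ #cov S (suc m)
  d*#cov≤#cov-suc S m = begin
    d P * #cov S m                     ≡⟨ ∑-const downsets (#cov S m) ⟨
    ∑ downsets (λ _ → #cov S m)        ≤⟨ ∑-mono-≤ downsets (λ a → #cov-antitone m (∩-⊆ˡ S a)) ⟩
    ∑[ a ← downsets ] #cov (S ∩ a) m   ≡⟨ #cov-suc S m ⟨
    #cov S (suc m)                     ∎
    where open ≤-Reasoning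

  m*#cov-suc<d*#cov*[m+2^k*d] : ∀ m → 0 < #cov K m →
    m * #cov K (suc m) < d P * #cov K m * (m + 2 ^ k * d P)
  m*#cov-suc<d*#cov*[m+2^k*d] m E>0 = begin-strict
    m * #cov K (suc m)                   ≤⟨ *-monoʳ-≤ m (#cov≤d^m K (suc m)) ⟩
    m * (D * D ^ m)                      ≡⟨ cong (λ x → m * (D * x)) (#cov+#uncov≡d^m K m) ⟨
    m * (D * (E + N))                    ≡⟨ distribute m D E N ⟩
    D * (m * E) + D * (m * N)            ≤⟨ +-monoʳ-≤ (D * (m * E)) (*-monoʳ-≤ D (m*#uncov≤#cov*#meet m K)) ⟩
    D * (m * E) + D * (E * #meet K)      <⟨ +-monoʳ-< (D * (m * E)) (*-monoʳ-< D {{>-nonZero d>0}}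
                                              (*-monoʳ-< E {{>-nonZero E>0}} #meet<2^k*d)) ⟩
    D * (m * E) + D * (E * (2 ^ k * D))  ≡⟨ collect m D E (2 ^ k * D) ⟩
    D * E * (m + 2 ^ k * D)              ∎
    where
    open ≤-Reasoning
    D = d P
    E = #cov K m
    N = #uncov K m
    #meet<2^k*d : #meet K < 2 ^ k * D
    #meet<2^k*d = <-≤-trans (#meet<d K) (m≤n*m D (2 ^ k) {{m^n≢0 2 k}})
    distribute : ∀ m D E N → m * (D * (E + N)) ≡ D * (m * E) + D * (m * N)
    distribute = solve-∀
    collect : ∀ m D E Y → D * (m * E) + D * (E * Y) ≡ D * E * (m + Y)
    collect = solve-∀

  2^k*d≤4^k : 2 ^ k * d P ≤ 4 ^ k
  2^k*d≤4^k = subst (2 ^ k * d P ≤_) (sym (^-distribʳ-* 2 2 k)) (*-monoʳ-≤ (2 ^ k) d≤2^k)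

theorem6p4 : ∀ {k} (P : FinPoset k) (m : ℕ) → 1 ≤ m →
    -- e(m,P) > 0, so the ratio is defined
    0 < e m P ×
    -- 1 ≤ e(m+1,P) / (d(P) e(m,P))
    d P * e m P ≤ e (suc m) P ×
    -- e(m+1,P) / (d(P) e(m,P)) < 1 + m⁻¹ 2^k d(P)
    m * e (suc m) P < (d P * e m P) * (m + 2 ^ k * d P) ×
    -- m⁻¹ 2^k d(P) ≤ m⁻¹ 4^k
    2 ^ k * d P ≤ 4 ^ k
theorem6p4 P zero ()
theorem6p4 P (suc m) _ rewrite e≡#cov P (suc m) | e≡#cov P (suc (suc m)) =
  #cov-suc>0 P K m ,
  d*#cov≤#cov-suc P K (suc m) ,
  m*#cov-suc<d*#cov*[m+2^k*d] P (suc m) (#cov-suc>0 P K m) ,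
  2^k*d≤4^k P
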